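{- The proof system $\mathbf{SLKvr}$ is sound and strongly complete with respect to the class $\mathcal{K}$ of all models: (i) every formula derivable in $\mathbf{SLKvr}$ is true at every world of every model in $\mathcal{K}$; (ii) every $\mathbf{SLKvr}$-consistent set $\Delta$ of formulas is satisfiable, i.e. there are a model $\mathcal{M}\in\mathcal{K}$ and a world $s$ of $\mathcal{M}$ such that $\mathcal{M},s\vDash\phi$ for all $\phi\in\Delta$.
   Context: Fix countably infinite sets $\mathbf{P}$ of proposition letters, $\mathbf{Ag}$ of agents and $\mathbf{D}$ of (non-rigid) constant symbols. Formulas are given by $\phi ::= \top\mid p\mid\neg\phi\mid(\phi\wedge\phi)\mid\Box_i\phi\mid\nabla_i(\phi,d)$ with $p\in\mathbf{P}$, $i\in\mathbf{Ag}$, $d\in\mathbf{D}$; $\bot,\vee,\to,\leftrightarrow$ are the usual abbreviations and $\Diamond_i\phi:=\neg\Box_i\neg\phi$. A model is $\mathcal{M}=\langle S,O,\{R_i\mid i\in\mathbf{Ag}\},V,V_{\mathbf{D}}\rangle$ with $S\neq\emptyset$ a set of worlds, $O\neq\emptyset$ a set of values, each $R_i\subseteq S\times S$ arbitrary, $V:\mathbf{P}\to\mathcal{P}(S)$, and $V_{\mathbf{D}}:\mathbf{D}\times S\to O$; $\mathcal{K}$ is the class of all such models. Truth: Boolean clauses as usual; $\mathcal{M},s\vDash\Box_i\phi$ iff $\mathcal{M},t\vDash\phi$ for all $t$ with $sR_it$; $\mathcal{M},s\vDash\nabla_i(\phi,d)$ iff for all $t_1,t_2$ with $sR_it_1$,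 $sR_it_2$, $\mathcal{M},t_1\vDash\phi$ and $\mathcal{M},t_2\vDash\phi$ we have $V_{\mathbf{D}}(d,t_1)=V_{\mathbf{D}}(d,t_2)$. The system $\mathbf{SLKvr}$ has axiom schemas: all propositional tautologies; $\Box_i(\phi\to\psi)\to(\Box_i\phi\to\Box_i\psi)$; $\Box_i(\phi\to\psi)\to(\nabla_i(\psi,d)\to\nabla_i(\phi,d))$; $\nabla_i(\bot,d)$; $\Diamond_i(\phi\wedge\psi)\wedge\nabla_i(\phi,d)\wedge\nabla_i(\psi,d)\to\nabla_i(\phi\vee\psi,d)$; and rules modus ponens, necessitation (from $\phi$ infer $\Box_i\phi$), and replacement of equivalents (from $\psi\leftrightarrow\chi$ infer $\phi\leftrightarrow\phi[\psi/\chi]$). A set $\Delta$ is $\mathbf{SLKvr}$-consistent if there is no finite $\Delta_0\subseteq\Delta$ with $\bigwedge\Delta_0\to\bot$ derivable. -}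

module Defs where

open import Data.Nat using (ℕ)
open import Data.Bool using (Bool; true; false; not; _∧_)
open import Data.List using (List; []; _∷_)
open import Data.List.Relation.Unary.All using (All)
open import Data.Product using (Σ; _×_; _,_; ∃)
open import Data.Empty using (⊥)
open import Data.Unit using (⊤)
open import Data.Sum using (_⊎_)
open import Relation.Nullary using (¬_; Dec; yes; no)
open import Relation.Binary.PropositionalEquality using (_≡_; refl; cong; cong₂)
import Data.Nat as N

Prop : Set
Prop = ℕ
Ag : Set
Ag = ℕ
Dc : Set
Dc = ℕ

infixr 6 _∧′_
data Formula : Set where
  ⊤′  : Formula
  var : Prop → Formula
  ¬′_ : Formula → Formula
  _∧′_ : Formula → Formula → Formula
  □ : Ag → Formula → Formula
  ∇ : Ag → Formula → Dc → Formula

⊥′ : Formula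
⊥′ = ¬′ ⊤′

_∨′_ : Formula → Formula → Formula
φ ∨′ ψ = ¬′ (¬′ φ ∧′ ¬′ ψ)

_⇒_ : Formula → Formula → Formula
φ ⇒ ψ = ¬′ (φ ∧′ ¬′ ψ)

_⇔_ : Formula → Formula → Formula
φ ⇔ ψ = (φ ⇒ ψ) ∧′ (ψ ⇒ φ)

◇ : Ag → Formula → Formula
◇ i φ = ¬′ □ i (¬′ φ)

-- Propositional tautologies: true under every Boolean valuation that treats
-- proposition letters and modal formulas (□ᵢφ, ∇ᵢ(φ,d)) as atoms.
evalB : (Prop → Bool) → (Formula → Bool) → Formula → Bool
evalB v w ⊤′ = true
evalB v w (var p) = v p
evalB v w (¬′ φ) = not (evalB v w φ)
evalB v w (φ ∧′ ψ) = evalB v w φ ∧ evalB v w ψ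
evalB v w (□ i φ) = w (□ i φ)
evalB v w (∇ i φ d) = w (∇ i φ d)

Tautology : Formula → Set
Tautology φ = (v : Prop → Bool) (w : Formula → Bool) → evalB v w φ ≡ true

_≟F_ : (φ ψ : Formula) → Dec (φ ≡ ψ)
⊤′ ≟F ⊤′ = yes refl
⊤′ ≟F var _ = no λ ()
⊤′ ≟F (¬′ _) = no λ ()
⊤′ ≟F (_ ∧′ _) = no λ ()
⊤′ ≟F □ _ _ = no λ ()
⊤′ ≟F ∇ _ _ _ = no λ ()
var _ ≟F ⊤′ = no λ ()
var p ≟F var q with p N.≟ q
... | yes refl = yes refl
... | no ne = no λ { refl → ne refl }
var _ ≟F (¬′ _) = no λ ()
var _ ≟F (_ ∧′ _) = no λ ()
var _ ≟F □ _ _ = no λ ()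
var _ ≟F ∇ _ _ _ = no λ ()
(¬′ _) ≟F ⊤′ = no λ ()
(¬′ _) ≟F var _ = no λ ()
(¬′ φ) ≟F (¬′ ψ) with φ ≟F ψ
... | yes refl = yes refl
... | no ne = no λ { refl → ne refl }
(¬′ _) ≟F (_ ∧′ _) = no λ ()
(¬′ _) ≟F □ _ _ = no λ ()
(¬′ _) ≟F ∇ _ _ _ = no λ ()
(_ ∧′ _) ≟F ⊤′ = no λ ()
(_ ∧′ _) ≟F var _ = no λ ()
(_ ∧′ _) ≟F (¬′ _) = no λ ()
(φ ∧′ φ′) ≟F (ψ ∧′ ψ′) with φ ≟F ψ | φ′ ≟F ψ′
... | yes refl | yes refl = yes refl
... | no ne | _ = no λ { refl → ne refl }
... | yes _ | no ne = no λ { refl → ne refl }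
(_ ∧′ _) ≟F □ _ _ = no λ ()
(_ ∧′ _) ≟F ∇ _ _ _ = no λ ()
□ _ _ ≟F ⊤′ = no λ ()
□ _ _ ≟F var _ = no λ ()
□ _ _ ≟F (¬′ _) = no λ ()
□ _ _ ≟F (_ ∧′ _) = no λ ()
□ i φ ≟F □ j ψ with i N.≟ j | φ ≟F ψ
... | yes refl | yes refl = yes refl
... | no ne | _ = no λ { refl → ne refl }
... | yes _ | no ne = no λ { refl → ne refl }
□ _ _ ≟F ∇ _ _ _ = no λ ()
∇ _ _ _ ≟F ⊤′ = no λ ()
∇ _ _ _ ≟F var _ = no λ ()
∇ _ _ _ ≟F (¬′ _) = no λ ()
∇ _ _ _ ≟F (_ ∧′ _) = no λ ()
∇ _ _ _ ≟F □ _ _ = no λ ()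
∇ i φ d ≟F ∇ j ψ e with i N.≟ j | φ ≟F ψ | d N.≟ e
... | yes refl | yes refl | yes refl = yes refl
... | no ne | _ | _ = no λ { refl → ne refl }
... | yes _ | no ne | _ = no λ { refl → ne refl }
... | yes _ | yes _ | no ne = no λ { refl → ne refl }

_[_/_] : Formula → Formula → Formula → Formula
φ [ ψ / χ ] with φ ≟F ψ
... | yes _ = χ
φ [ ψ / χ ] | no _ = go φ
  where
  go : Formula → Formula
  go ⊤′ = ⊤′
  go (var p) = var p
  go (¬′ α) = ¬′ (α [ ψ / χ ])
  go (α ∧′ β) = (α [ ψ / χ ]) ∧′ (β [ ψ / χ ])
  go (□ i α) = □ i (α [ ψ / χ ])
  go (∇ i α d) = ∇ i (α [ ψ / χ ]) d

infix 3 ⊢_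
data ⊢_ : Formula → Set where
  taut   : ∀ {φ} → Tautology φ → ⊢ φ
  axK    : ∀ i φ ψ → ⊢ (□ i (φ ⇒ ψ) ⇒ (□ i φ ⇒ □ i ψ))
  axMono : ∀ i φ ψ d → ⊢ (□ i (φ ⇒ ψ) ⇒ (∇ i ψ d ⇒ ∇ i φ d))
  axBot  : ∀ i d → ⊢ ∇ i ⊥′ d
  axUnion : ∀ i φ ψ d →
    ⊢ ((◇ i (φ ∧′ ψ) ∧′ (∇ i φ d ∧′ ∇ i ψ d)) ⇒ ∇ i (φ ∨′ ψ) d)
  mp     : ∀ {φ ψ} → ⊢ (φ ⇒ ψ) → ⊢ φ → ⊢ ψ
  nec    : ∀ {φ} i → ⊢ φ → ⊢ □ i φ
  repl   : ∀ {ψ χ} (φ : Formula) → ⊢ (ψ ⇔ χ) → ⊢ (φ ⇔ (φ [ ψ / χ ]))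

FSet : Set₁
FSet = Formula → Set

conj : List Formula → Formula
conj [] = ⊤′
conj (φ ∷ φs) = φ ∧′ conj φs

Consistent : FSet → Set
Consistent Δ = (Δ₀ : List Formula) → All Δ Δ₀ → ¬ (⊢ (conj Δ₀ ⇒ ⊥′))

record Model : Set₁ where
  field
    S   : Set
    O   : Set
    s₀  : S          -- S ≠ ∅
    o₀  : O          -- O ≠ ∅
    R   : Ag → S → S → Set
    V   : Prop → S → Set
    VD  : Dc → S → O
open Model public

_,_⊨_ : (M : Model) → S M → Formula → Set
M , s ⊨ ⊤′ = ⊤
M , s ⊨ var p = V M p s
M , s ⊨ (¬′ φ) = ¬ (M , s ⊨ φ)
M , s ⊨ (φ ∧′ ψ) = (M , s ⊨ φ) × (M , s ⊨ ψ)
M , s ⊨ □ i φ = ∀ t → R M i s t → M , t ⊨ φ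
M , s ⊨ ∇ i φ d = ∀ t₁ t₂ → R M i s t₁ → R M i s t₂ →
  M , t₁ ⊨ φ → M , t₂ ⊨ φ → VD M d t₁ ≡ VD M d t₂

Satisfiable : FSet → Set₁
Satisfiable Δ = Σ Model λ M → Σ (S M) λ s → ∀ φ → Δ φ → M , s ⊨ φ

LEM : Set₁
LEM = (A : Set) → A ⊎ (¬ A)

-- Soundness is checked axiom by axiom; the union axiom holds because a world satisfying
-- φ ∧ ψ links the values of d on φ-worlds with those on ψ-worlds.
--
-- Completeness uses a canonical model of maximal consistent sets, unravelled into a tree so
-- that the value of d at an i-successor Δ of Γ may depend on Γ.  That value is the least n
-- such that the n-th formula θ is linked to Δ: some ψ ∈ Δ has ∇ᵢ(ψ,d), ∇ᵢ(θ ∨ ψ,d) and ◇ᵢθ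
-- in Γ.  If ∇ᵢ(φ,d) ∈ Γ, the union axiom shows that two φ-successors have the same linked
-- indices, hence the same value.  If ∇ᵢ(φ,d) ∉ Γ, a φ-successor Δ₀ is paired either with a
-- second copy of itself (when no formula of Δ₀ is ∇-known in Γ) or with a φ-successor that
-- refutes every ∇-known formula of Δ₀; a common linked index would yield a ∇-known formula
-- in both.

module Submission where

open import Defs
open import Data.Bool using (Bool; true; false; not; _∧_; T)
open import Data.Bool.Properties using (T-≡; T-∧)
open import Data.Fin using (Fin; zero; suc)
open import Data.List using (List; []; _∷_; _++_)
open import Data.List.Relation.Unary.All as All using (All; []; _∷_)
open import Data.List.Relation.Unary.All.Properties using (++⁺)
open import Data.Nat using (ℕ; zero; suc; _+_; _<_; _≤_; _≤′_; ≤′-refl; ≤′-step; _⊔_; s≤s)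
open import Data.Nat.Induction using (<-rec)
open import Data.Nat.Properties
  using (suc-injective; +-suc; +-identityʳ; ≤-refl; ≤-trans; ≤-antisym; ≮⇒≥; ≤⇒≤′; m≤m⊔n; m≤n⊔m)
open import Data.Product using (Σ; ∃; _×_; _,_; proj₁; proj₂; uncurry)
open import Data.Sum as Sum using (_⊎_; inj₁; inj₂)
open import Data.Empty using (⊥-elim)
open import Data.Unit using (tt)
open import Data.Vec using (Vec; []; _∷_; lookup; map)
open import Data.Vec.Properties using (lookup-map)
open import Function using (_∘_)
open import Function.Bundles using (Equivalence)
open import Relation.Nullary using (¬_; contradiction; yes; no)
open import Relation.Nullary.Decidable using (does; fromSum; dec-true; dec-false)
open import Relation.Binary.PropositionalEquality
  using (_≡_; _≢_; refl; sym; trans; cong; cong₂; module ≡-Reasoning)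

-- Enumerating formulas

next : ℕ × ℕ → ℕ × ℕ
next (a , zero)  = zero , suc a
next (a , suc b) = suc a , b

unpair : ℕ → ℕ × ℕ
unpair zero    = 0 , 0
unpair (suc n) = next (unpair n)

-- The index s = a + b makes the recursion structural: each call lowers s, or keeps s and lowers a.
unpair-onto : ∀ {s} a b → a + b ≡ s → ∃ λ n → unpair n ≡ (a , b)
unpair-onto zero zero _ = 0 , refl
unpair-onto {suc s} zero (suc b) eq
  with unpair-onto {s} b zero (trans (+-identityʳ b) (suc-injective eq))
... | n , eq′ = suc n , cong next eq′
unpair-onto (suc a) b eq with unpair-onto a (suc b) (trans (+-suc a b) eq)
... | n , eq′ = suc n , cong next eq′

pair : ℕ → ℕ → ℕ
pair a b = proj₁ (unpair-onto a b refl)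

unpair-pair : ∀ a b → unpair (pair a b) ≡ (a , b)
unpair-pair a b = proj₂ (unpair-onto a b refl)

-- decode k n reads n as a pair (constructor tag, payload), compound payloads being pairs again;
-- the fuel k bounds the nesting depth.
decode : ℕ → ℕ → Formula
node : ℕ → ℕ → ℕ → Formula

decode zero    n = ⊤′
decode (suc k) n = uncurry (node k) (unpair n)

node k 0 p = var p
node k 1 m = ¬′ decode k m
node k 2 m = uncurry (λ a b → decode k a ∧′ decode k b) (unpair m)
node k 3 m = uncurry (λ i a → □ i (decode k a)) (unpair m)
node k 4 m = uncurry (λ i m′ → uncurry (λ a d → ∇ i (decode k a) d) (unpair m′)) (unpair m)
node k _ m = ⊤′

decode-⊤ : ∀ k → decode (suc k) (pair 5 0) ≡ ⊤′
decode-⊤ k rewrite unpair-pair 5 0 = refl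

decode-var : ∀ k p → decode (suc k) (pair 0 p) ≡ var p
decode-var k p rewrite unpair-pair 0 p = refl

decode-¬ : ∀ k a → decode (suc k) (pair 1 a) ≡ ¬′ decode k a
decode-¬ k a rewrite unpair-pair 1 a = refl

decode-∧ : ∀ k a b → decode (suc k) (pair 2 (pair a b)) ≡ decode k a ∧′ decode k b
decode-∧ k a b rewrite unpair-pair 2 (pair a b) | unpair-pair a b = refl

decode-□ : ∀ k i a → decode (suc k) (pair 3 (pair i a)) ≡ □ i (decode k a)
decode-□ k i a rewrite unpair-pair 3 (pair i a) | unpair-pair i a = refl

decode-∇ : ∀ k i a d → decode (suc k) (pair 4 (pair i (pair a d))) ≡ ∇ i (decode k a) d
decode-∇ k i a d
  rewrite unpair-pair 4 (pair i (pair a d)) | unpair-pair i (pair a d) | unpair-pair a d = refl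

decode-onto : ∀ φ → ∃ λ k → ∀ {j} → k ≤ j → ∃ λ n → decode j n ≡ φ
decode-onto ⊤′ = 0 , λ { {zero} _ → 0 , refl ; {suc j} _ → pair 5 0 , decode-⊤ j }
decode-onto (var p) = 1 , λ { {suc j} _ → pair 0 p , decode-var j p }
decode-onto (¬′ φ) with decode-onto φ
... | k , dφ = suc k , λ { {suc j} (s≤s k≤j) →
  let a , eq = dφ k≤j in pair 1 a , trans (decode-¬ j a) (cong ¬′_ eq) }
decode-onto (φ ∧′ ψ) with decode-onto φ | decode-onto ψ
... | k , dφ | l , dψ = suc (k ⊔ l) , λ { {suc j} (s≤s k⊔l≤j) →
  let a , eqφ = dφ (≤-trans (m≤m⊔n k l) k⊔l≤j)
      b , eqψ = dψ (≤-trans (m≤n⊔m k l) k⊔l≤j)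
  in pair 2 (pair a b) , trans (decode-∧ j a b) (cong₂ _∧′_ eqφ eqψ) }
decode-onto (□ i φ) with decode-onto φ
... | k , dφ = suc k , λ { {suc j} (s≤s k≤j) →
  let a , eq = dφ k≤j in pair 3 (pair i a) , trans (decode-□ j i a) (cong (□ i) eq) }
decode-onto (∇ i φ d) with decode-onto φ
... | k , dφ = suc k , λ { {suc j} (s≤s k≤j) →
  let a , eq = dφ k≤j
  in pair 4 (pair i (pair a d)) , trans (decode-∇ j i a d) (cong (λ α → ∇ i α d) eq) }

enum : ℕ → Formula
enum n = uncurry decode (unpair n)

enum-onto : ∀ φ → ∃ λ n → enum n ≡ φ
enum-onto φ with decode-onto φ
... | k , dφ with dφ ≤-refl
... | n , eq = pair k n , trans (cong (uncurry decode) (unpair-pair k n)) eq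

-- Propositional reasoning

-- A tautology is written once, as a schema instantiated at a vector of formulas.  The side
-- condition Valid s evaluates s under all 2ⁿ assignments, so for a valid schema it computes
-- to ⊤ and is filled in silently.
infixr 4 _⊃_
infixr 5 _∣_
infixr 6 _&_
infix 7 ~_

data Schema (n : ℕ) : Set where
  ⊤ₛ  : Schema n
  `_  : Fin n → Schema n
  ~_  : Schema n → Schema n
  _&_ : Schema n → Schema n → Schema n

⊥ₛ : ∀ {n} → Schema n
⊥ₛ = ~ ⊤ₛ

_⊃_ _∣_ : ∀ {n} → Schema n → Schema n → Schema n
s ⊃ t = ~ (s & ~ t)
s ∣ t = ~ (~ s & ~ t)

A : ∀ {n} → Schema (suc n)
A = ` zero
B : ∀ {n} → Schema (suc (suc n))
B = ` suc zero
C : ∀ {n} → Schema (suc (suc (suc n)))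
C = ` suc (suc zero)
D : ∀ {n} → Schema (suc (suc (suc (suc n))))
D = ` suc (suc (suc zero))

_⟨_⟩ : ∀ {n} → Schema n → Vec Formula n → Formula
⊤ₛ      ⟨ σ ⟩ = ⊤′
(` k)   ⟨ σ ⟩ = lookup σ k
(~ s)   ⟨ σ ⟩ = ¬′ (s ⟨ σ ⟩)
(s & t) ⟨ σ ⟩ = s ⟨ σ ⟩ ∧′ t ⟨ σ ⟩

⟦_⟧ : ∀ {n} → Schema n → Vec Bool n → Bool
⟦ ⊤ₛ ⟧    ρ = true
⟦ ` k ⟧   ρ = lookup ρ k
⟦ ~ s ⟧   ρ = not (⟦ s ⟧ ρ)
⟦ s & t ⟧ ρ = ⟦ s ⟧ ρ ∧ ⟦ t ⟧ ρ

evalB-⟨⟩ : ∀ {n} v w (s : Schema n) σ → evalB v w (s ⟨ σ ⟩) ≡ ⟦ s ⟧ (map (evalB v w) σ)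
evalB-⟨⟩ v w ⊤ₛ      σ = refl
evalB-⟨⟩ v w (` k)   σ = sym (lookup-map k (evalB v w) σ)
evalB-⟨⟩ v w (~ s)   σ = cong not (evalB-⟨⟩ v w s σ)
evalB-⟨⟩ v w (s & t) σ = cong₂ _∧_ (evalB-⟨⟩ v w s σ) (evalB-⟨⟩ v w t σ)

all : ∀ {n} → (Vec Bool n → Bool) → Bool
all {zero}  f = f []
all {suc n} f = all (λ ρ → f (true ∷ ρ)) ∧ all (λ ρ → f (false ∷ ρ))

all-sound : ∀ {n} (f : Vec Bool n → Bool) → T (all f) → ∀ ρ → T (f ρ)
all-sound {zero}  f ok [] = ok
all-sound {suc n} f ok (true  ∷ ρ) = all-sound _ (proj₁ (Equivalence.to T-∧ ok)) ρ
all-sound {suc n} f ok (false ∷ ρ) = all-sound _ (proj₂ (Equivalence.to T-∧ ok)) ρ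

Valid : ∀ {n} → Schema n → Set
Valid s = T (all ⟦ s ⟧)

tautology : ∀ {n} (s : Schema n) {_ : Valid s} (σ : Vec Formula n) → ⊢ s ⟨ σ ⟩
tautology s {ok} σ = taut λ v w →
  trans (evalB-⟨⟩ v w s σ) (Equivalence.to T-≡ (all-sound ⟦ s ⟧ ok (map (evalB v w) σ)))

infix 4 _⊢*_ _⊆_
infixl 5 _∪_

_⊆_ : FSet → FSet → Set
X ⊆ Y = ∀ {φ} → X φ → Y φ

_∪_ : FSet → FSet → FSet
(X ∪ Y) φ = X φ ⊎ Y φ

｛_｝ : Formula → FSet
｛ φ ｝ ψ = ψ ≡ φ

_⊢*_ : FSet → Formula → Set
X ⊢* φ = Σ (List Formula) λ L → All X L × ⊢ conj L ⇒ φ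

⊢-trans : ∀ {φ ψ χ} → ⊢ φ ⇒ ψ → ⊢ ψ ⇒ χ → ⊢ φ ⇒ χ
⊢-trans {φ} {ψ} {χ} p q = mp (mp (tautology ((A ⊃ B) ⊃ (B ⊃ C) ⊃ (A ⊃ C)) (φ ∷ ψ ∷ χ ∷ [])) p) q

conj-++ : ∀ L₁ L₂ → ⊢ conj (L₁ ++ L₂) ⇒ (conj L₁ ∧′ conj L₂)
conj-++ []       L₂ = tautology (A ⊃ ⊤ₛ & A) (conj L₂ ∷ [])
conj-++ (α ∷ L₁) L₂ =
  mp (tautology ((B ⊃ C & D) ⊃ (A & B ⊃ (A & C) & D)) (α ∷ conj (L₁ ++ L₂) ∷ conj L₁ ∷ conj L₂ ∷ []))
     (conj-++ L₁ L₂)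

module _ {X : FSet} where

  ⊢*-theorem : ∀ {φ} → ⊢ φ → X ⊢* φ
  ⊢*-theorem {φ} p = [] , [] , mp (tautology (A ⊃ ⊤ₛ ⊃ A) (φ ∷ [])) p

  ⊢*-member : ∀ {φ} → X φ → X ⊢* φ
  ⊢*-member {φ} x = φ ∷ [] , x ∷ [] , tautology (A & ⊤ₛ ⊃ A) (φ ∷ [])

  ⊢*-mp : ∀ {φ ψ} → ⊢ φ ⇒ ψ → X ⊢* φ → X ⊢* ψ
  ⊢*-mp p (L , L⊆X , q) = L , L⊆X , ⊢-trans q p

  ⊢*-∧ : ∀ {φ ψ} → X ⊢* φ → X ⊢* ψ → X ⊢* (φ ∧′ ψ)
  ⊢*-∧ {φ} {ψ} (L₁ , L₁⊆X , p) (L₂ , L₂⊆X , q) =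
    L₁ ++ L₂ , ++⁺ L₁⊆X L₂⊆X ,
    ⊢-trans (conj-++ L₁ L₂)
            (mp (mp (tautology ((A ⊃ C) ⊃ (B ⊃ D) ⊃ (A & B ⊃ C & D))
                               (conj L₁ ∷ conj L₂ ∷ φ ∷ ψ ∷ [])) p) q)

  ⊢*-conj : ∀ {L} → All (X ⊢*_) L → X ⊢* conj L
  ⊢*-conj []       = ⊢*-theorem (tautology ⊤ₛ [])
  ⊢*-conj (p ∷ ps) = ⊢*-∧ p (⊢*-conj ps)

  ⊢*-cut : ∀ {L φ} → All (X ⊢*_) L → ⊢ conj L ⇒ φ → X ⊢* φ
  ⊢*-cut ps p = ⊢*-mp p (⊢*-conj ps)

  deduction : ∀ {φ ψ} → X ∪ ｛ φ ｝ ⊢* ψ → X ⊢* φ ⇒ ψ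
  deduction {φ} (L , L⊆ , p) = go L L⊆ p
    where
    assumed : ∀ {α} → (X ∪ ｛ φ ｝) α → X ⊢* φ ⇒ α
    assumed {α} (inj₁ x)    = ⊢*-mp (tautology (A ⊃ B ⊃ A) (α ∷ φ ∷ [])) (⊢*-member x)
    assumed     (inj₂ refl) = ⊢*-theorem (tautology (A ⊃ A) (φ ∷ []))
    go : ∀ L {ψ} → All (X ∪ ｛ φ ｝) L → ⊢ conj L ⇒ ψ → X ⊢* φ ⇒ ψ
    go []      {ψ} []       p = ⊢*-theorem (mp (tautology ((⊤ₛ ⊃ B) ⊃ (A ⊃ B)) (φ ∷ ψ ∷ [])) p)
    go (α ∷ L) {ψ} (a ∷ as) p =
      ⊢*-mp (tautology ((A ⊃ B ⊃ C) & (A ⊃ B) ⊃ (A ⊃ C)) (φ ∷ α ∷ ψ ∷ []))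
            (⊢*-∧ (go L as (mp (tautology ((A & B ⊃ C) ⊃ (B ⊃ A ⊃ C)) (α ∷ conj L ∷ ψ ∷ [])) p))
                  (assumed a))

⊬⊥ : ∀ {X} → Consistent X → ¬ X ⊢* ⊥′
⊬⊥ c (L , L⊆X , p) = c L L⊆X p

-- Maximal consistent sets

-- Membership is Bool-valued so that MCS, and with it the canonical worlds, lives in Set.
record MCS : Set where
  field
    member     : Formula → Bool
    consistent : Consistent (λ φ → member φ ≡ true)
    maximal    : ∀ φ → member φ ≡ true ⊎ member (¬′ φ) ≡ true

infix 4 _∋_

data _∋_ (Γ : MCS) (φ : Formula) : Set where
  holds : MCS.member Γ φ ≡ true → Γ ∋ φ

module _ {Γ : MCS} where
  open MCS Γ

  ∋-maximal : ∀ φ → Γ ∋ φ ⊎ Γ ∋ ¬′ φ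
  ∋-maximal φ with maximal φ
  ... | inj₁ t = inj₁ (holds t)
  ... | inj₂ t = inj₂ (holds t)

  ∋-consistent : Consistent (Γ ∋_)
  ∋-consistent L L⊆Γ = consistent L (All.map (λ { (holds t) → t }) L⊆Γ)

  ∋-closed : ∀ {φ} → (Γ ∋_) ⊢* φ → Γ ∋ φ
  ∋-closed {φ} (L , L⊆Γ , p) with ∋-maximal φ
  ... | inj₁ φ∈ = φ∈
  ... | inj₂ ¬φ∈ = ⊥-elim (∋-consistent (¬′ φ ∷ L) (¬φ∈ ∷ L⊆Γ)
                     (mp (tautology ((B ⊃ A) ⊃ (~ A & B ⊃ ⊥ₛ)) (φ ∷ conj L ∷ [])) p))

  ∋-theorem : ∀ {φ} → ⊢ φ → Γ ∋ φ
  ∋-theorem p = ∋-closed (⊢*-theorem p)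

  ∋-mp : ∀ {φ ψ} → Γ ∋ φ ⇒ ψ → Γ ∋ φ → Γ ∋ ψ
  ∋-mp {φ} {ψ} φ⇒ψ∈ φ∈ =
    ∋-closed (_ , φ⇒ψ∈ ∷ φ∈ ∷ [] , tautology ((A ⊃ B) & A & ⊤ₛ ⊃ B) (φ ∷ ψ ∷ []))

  ∋-derive : ∀ {φ ψ} → ⊢ φ ⇒ ψ → Γ ∋ φ → Γ ∋ ψ
  ∋-derive p = ∋-mp (∋-theorem p)

  ∋-∧ : ∀ {φ ψ} → Γ ∋ φ → Γ ∋ ψ → Γ ∋ φ ∧′ ψ
  ∋-∧ {φ} {ψ} φ∈ ψ∈ = ∋-closed (_ , φ∈ ∷ ψ∈ ∷ [] , tautology (A & B & ⊤ₛ ⊃ A & B) (φ ∷ ψ ∷ []))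

  ∋-∧₁ : ∀ {φ ψ} → Γ ∋ φ ∧′ ψ → Γ ∋ φ
  ∋-∧₁ {φ} {ψ} = ∋-derive (tautology (A & B ⊃ A) (φ ∷ ψ ∷ []))

  ∋-∧₂ : ∀ {φ ψ} → Γ ∋ φ ∧′ ψ → Γ ∋ ψ
  ∋-∧₂ {φ} {ψ} = ∋-derive (tautology (A & B ⊃ B) (φ ∷ ψ ∷ []))

  ∋-¬ : ∀ {φ} → Γ ∋ ¬′ φ → ¬ Γ ∋ φ
  ∋-¬ {φ} ¬φ∈ φ∈ = ∋-consistent _ (¬φ∈ ∷ φ∈ ∷ []) (tautology (~ A & A & ⊤ₛ ⊃ ⊥ₛ) (φ ∷ []))

  ∌-¬ : ∀ {φ} → ¬ Γ ∋ φ → Γ ∋ ¬′ φ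
  ∌-¬ {φ} φ∉ with ∋-maximal φ
  ... | inj₁ φ∈  = ⊥-elim (φ∉ φ∈)
  ... | inj₂ ¬φ∈ = ¬φ∈

⇒-intro : ∀ {A B : Set} → (A → B) → ¬ (A × ¬ B)
⇒-intro f (a , ¬b) = ¬b (f a)

module Classical (lem : LEM) where

  ⌊_⌋ : Set → Bool
  ⌊ A ⌋ = does (fromSum (lem A))

  ⌊⌋-true : ∀ {A} → A → ⌊ A ⌋ ≡ true
  ⌊⌋-true {A} = dec-true (fromSum (lem A))

  ⌊⌋-false : ∀ {A} → ¬ A → ⌊ A ⌋ ≡ false
  ⌊⌋-false {A} = dec-false (fromSum (lem A))

  ⌊⌋-elim : ∀ {A} → ⌊ A ⌋ ≡ true → A
  ⌊⌋-elim {A} with lem A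
  ... | inj₁ a = λ _ → a
  ... | inj₂ _ = λ ()

  ¬¬-elim : ∀ {A : Set} → ¬ ¬ A → A
  ¬¬-elim {A} ¬¬a with lem A
  ... | inj₁ a  = a
  ... | inj₂ ¬a = contradiction ¬a ¬¬a

  ⇒-elim : ∀ {A B : Set} → ¬ (A × ¬ B) → A → B
  ⇒-elim ¬[a×¬b] a = ¬¬-elim λ ¬b → ¬[a×¬b] (a , ¬b)

  ∨-elim : ∀ {A B : Set} → ¬ (¬ A × ¬ B) → A ⊎ B
  ∨-elim {A} ¬[¬a×¬b] with lem A
  ... | inj₁ a  = inj₁ a
  ... | inj₂ ¬a = inj₂ (⇒-elim ¬[¬a×¬b] ¬a)

  ¬∀¬⇒∃ : ∀ {X : Set} {P Q : X → Set} → ¬ (∀ x → P x → ¬ Q x) → ∃ λ x → P x × Q x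
  ¬∀¬⇒∃ ¬∀ = ¬¬-elim λ ¬∃ → ¬∀ λ x Px Qx → ¬∃ (x , Px , Qx)

  ⌊¬⌋ : ∀ {A} → ⌊ ¬ A ⌋ ≡ not ⌊ A ⌋
  ⌊¬⌋ {A} with lem A
  ... | inj₁ a  = ⌊⌋-false λ ¬a → ¬a a
  ... | inj₂ ¬a = ⌊⌋-true ¬a

  ⌊×⌋ : ∀ {A B} → ⌊ A × B ⌋ ≡ ⌊ A ⌋ ∧ ⌊ B ⌋
  ⌊×⌋ {A} {B} with lem A | lem B
  ... | inj₁ a  | inj₁ b  = ⌊⌋-true (a , b)
  ... | inj₁ _  | inj₂ ¬b = ⌊⌋-false (¬b ∘ proj₂)
  ... | inj₂ ¬a | _       = ⌊⌋-false (¬a ∘ proj₁)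

module _ (lem : LEM) where
  open Classical lem

  extend : FSet → Formula → FSet
  extend X φ with lem (Consistent (X ∪ ｛ φ ｝))
  ... | inj₁ _ = X ∪ ｛ φ ｝
  ... | inj₂ _ = X ∪ ｛ ¬′ φ ｝

  ⊆-extend : ∀ {X} φ → X ⊆ extend X φ
  ⊆-extend {X} φ x with lem (Consistent (X ∪ ｛ φ ｝))
  ... | inj₁ _ = inj₁ x
  ... | inj₂ _ = inj₁ x

  extend-decides : ∀ X φ → extend X φ φ ⊎ extend X φ (¬′ φ)
  extend-decides X φ with lem (Consistent (X ∪ ｛ φ ｝))
  ... | inj₁ _ = inj₁ (inj₂ refl)
  ... | inj₂ _ = inj₂ (inj₂ refl)

  extend-consistent : ∀ {X} φ → Consistent X → Consistent (extend X φ)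
  extend-consistent {X} φ cX with lem (Consistent (X ∪ ｛ φ ｝))
  ... | inj₁ c = c
  ... | inj₂ ¬c = λ L L⊆ p → ¬c λ L′ L′⊆ p′ → ⊬⊥ cX
    (⊢*-mp (tautology ((A ⊃ ⊥ₛ) & (~ A ⊃ ⊥ₛ) ⊃ ⊥ₛ) (φ ∷ []))
           (⊢*-∧ (deduction (L′ , L′⊆ , p′)) (deduction (L , L⊆ , p))))

  module Lindenbaum (X : FSet) (cX : Consistent X) where

    chain : ℕ → FSet
    chain zero    = X
    chain (suc n) = extend (chain n) (enum n)

    chain-mono : ∀ {m n} → m ≤′ n → chain m ⊆ chain n
    chain-mono ≤′-refl        x = x
    chain-mono (≤′-step m≤′n) x = ⊆-extend _ (chain-mono m≤′n x)

    chain-consistent : ∀ n → Consistent (chain n)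
    chain-consistent zero    = cX
    chain-consistent (suc n) = extend-consistent (enum n) (chain-consistent n)

    Limit : FSet
    Limit φ = ∃ λ n → chain n φ

    finite-stage : ∀ {L} → All Limit L → ∃ λ n → All (chain n) L
    finite-stage []              = 0 , []
    finite-stage ((m , x) ∷ L⊆) with finite-stage L⊆
    ... | n , L⊆chain = m ⊔ n , chain-mono (≤⇒≤′ (m≤m⊔n m n)) x
                              ∷ All.map (chain-mono (≤⇒≤′ (m≤n⊔m m n))) L⊆chain

    limit-consistent : Consistent Limit
    limit-consistent L L⊆ with finite-stage L⊆
    ... | n , L⊆chain = chain-consistent n L L⊆chain

    limit-maximal : ∀ φ → Limit φ ⊎ Limit (¬′ φ)
    limit-maximal φ with enum-onto φ
    ... | n , refl with extend-decides (chain n) (enum n)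
    ... | inj₁ x = inj₁ (suc n , x)
    ... | inj₂ x = inj₂ (suc n , x)

    limit : MCS
    limit = record
      { member     = λ φ → ⌊ Limit φ ⌋
      ; consistent = λ L L⊆ → limit-consistent L (All.map ⌊⌋-elim L⊆)
      ; maximal    = λ φ → Sum.map ⌊⌋-true ⌊⌋-true (limit-maximal φ)
      }

  lindenbaum : ∀ {X} → Consistent X → Σ MCS λ Γ → ∀ {φ} → X φ → Γ ∋ φ
  lindenbaum {X} cX = limit , λ x → holds (⌊⌋-true (0 , x))
    where open Lindenbaum X cX

-- The canonical model

Least : (ℕ → Set) → ℕ → Set
Least P n = P n × (∀ {m} → m < n → ¬ P m)

least-unique : ∀ {P Q : ℕ → Set} {m n} → (∀ {k} → P k → Q k) → (∀ {k} → Q k → P k) →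
               Least P m → Least Q n → m ≡ n
least-unique P⊆Q Q⊆P (Pm , below-m) (Qn , below-n) =
  ≤-antisym (≮⇒≥ λ n<m → below-m n<m (Q⊆P Qn)) (≮⇒≥ λ m<n → below-n m<n (P⊆Q Pm))

Boxed : MCS → Ag → FSet
Boxed Γ i φ = Γ ∋ □ i φ

_⟶[_]_ : MCS → Ag → MCS → Set
Γ ⟶[ i ] Δ = Boxed Γ i ⊆ (Δ ∋_)

module _ {Γ : MCS} {i : Ag} where

  □-mono : ∀ {φ ψ} → ⊢ φ ⇒ ψ → Γ ∋ □ i φ → Γ ∋ □ i ψ
  □-mono {φ} {ψ} p = ∋-mp (∋-theorem (mp (axK i φ ψ) (nec i p)))

  □-closed : ∀ {φ} → Boxed Γ i ⊢* φ → Γ ∋ □ i φ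
  □-closed (L , L⊆ , p) = unfold L L⊆ (∋-theorem (nec i p))
    where
    unfold : ∀ L {φ} → All (Boxed Γ i) L → Γ ∋ □ i (conj L ⇒ φ) → Γ ∋ □ i φ
    unfold []      {φ} []        = □-mono (tautology ((⊤ₛ ⊃ A) ⊃ A) (φ ∷ []))
    unfold (α ∷ L) {φ} (□α ∷ L⊆) □α∧L⇒φ =
      unfold L L⊆ (∋-mp (∋-mp (∋-theorem (axK i α (conj L ⇒ φ))) □α⇒L⇒φ) □α)
      where
      □α⇒L⇒φ : Γ ∋ □ i (α ⇒ (conj L ⇒ φ))
      □α⇒L⇒φ = □-mono (tautology ((A & B ⊃ C) ⊃ (A ⊃ B ⊃ C)) (α ∷ conj L ∷ φ ∷ [])) □α∧L⇒φ

  ◇-mono : ∀ {φ ψ} → ⊢ φ ⇒ ψ → Γ ∋ ◇ i φ → Γ ∋ ◇ i ψ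
  ◇-mono {φ} {ψ} p ◇φ =
    ∌-¬ λ □¬ψ → ∋-¬ ◇φ (□-mono (mp (tautology ((A ⊃ B) ⊃ (~ B ⊃ ~ A)) (φ ∷ ψ ∷ [])) p) □¬ψ)

  ◇-intro : ∀ {Δ φ} → Γ ⟶[ i ] Δ → Δ ∋ φ → Γ ∋ ◇ i φ
  ◇-intro Γ⟶Δ φ∈ = ∌-¬ λ □¬φ → ∋-¬ (Γ⟶Δ □¬φ) φ∈

  module _ {d : Dc} where

    ∇-□-antitone : ∀ {φ ψ} → Γ ∋ □ i (φ ⇒ ψ) → Γ ∋ ∇ i ψ d → Γ ∋ ∇ i φ d
    ∇-□-antitone {φ} {ψ} □φ⇒ψ = ∋-mp (∋-mp (∋-theorem (axMono i φ ψ d)) □φ⇒ψ)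

    ∇-antitone : ∀ {φ ψ} → ⊢ φ ⇒ ψ → Γ ∋ ∇ i ψ d → Γ ∋ ∇ i φ d
    ∇-antitone p = ∇-□-antitone (∋-theorem (nec i p))

    ∇-∨ : ∀ {φ ψ} → Γ ∋ ◇ i (φ ∧′ ψ) → Γ ∋ ∇ i φ d → Γ ∋ ∇ i ψ d → Γ ∋ ∇ i (φ ∨′ ψ) d
    ∇-∨ {φ} {ψ} ◇φψ ∇φ ∇ψ = ∋-mp (∋-theorem (axUnion i φ ψ d)) (∋-∧ ◇φψ (∋-∧ ∇φ ∇ψ))

    ∇-∨-successor : ∀ {Δ φ ψ} → Γ ⟶[ i ] Δ → Δ ∋ φ → Δ ∋ ψ →
                    Γ ∋ ∇ i φ d → Γ ∋ ∇ i ψ d → Γ ∋ ∇ i (φ ∨′ ψ) d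
    ∇-∨-successor Γ⟶Δ φ∈ ψ∈ = ∇-∨ (◇-intro Γ⟶Δ (∋-∧ φ∈ ψ∈))

    ∇-⊥ : Γ ∋ ∇ i ⊥′ d
    ∇-⊥ = ∋-theorem (axBot i d)

□-consistent : ∀ {Γ i φ} → ¬ Γ ∋ □ i φ → Consistent (Boxed Γ i ∪ ｛ ¬′ φ ｝)
□-consistent {φ = φ} □φ∉ L L⊆ p =
  □φ∉ (□-closed (⊢*-mp (tautology ((~ A ⊃ ⊥ₛ) ⊃ A) (φ ∷ [])) (deduction (L , L⊆ , p))))

∇-consistent : ∀ {Γ i φ d} → ¬ Γ ∋ ∇ i φ d → Consistent (Boxed Γ i ∪ ｛ φ ｝)
∇-consistent ∇φ∉ L L⊆ p = ∇φ∉ (∇-□-antitone (□-closed (deduction (L , L⊆ , p))) ∇-⊥)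

module Linkage (Γ : MCS) (i : Ag) (d : Dc) where

  record Linked (Δ : MCS) (n : ℕ) : Set where
    constructor linked
    field
      ψ   : Formula
      ψ∈  : Δ ∋ ψ
      ∇ψ  : Γ ∋ ∇ i ψ d
      ∇nψ : Γ ∋ ∇ i (enum n ∨′ ψ) d
      ◇n  : Γ ∋ ◇ i (enum n)

  linked-exists : ∀ {Δ θ} → Γ ⟶[ i ] Δ → Δ ∋ θ → Γ ∋ ∇ i θ d → ∃ (Linked Δ)
  linked-exists {θ = θ} Γ⟶Δ θ∈ ∇θ with enum-onto θ
  ... | n , refl = n , linked θ θ∈ ∇θ (∇-antitone (tautology (A ∣ A ⊃ A) (θ ∷ [])) ∇θ) (◇-intro Γ⟶Δ θ∈)

  linked-transfer : ∀ {Δ₁ Δ₂ θ n} → Γ ⟶[ i ] Δ₁ → Δ₁ ∋ θ → Δ₂ ∋ θ → Γ ∋ ∇ i θ d →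
                    Linked Δ₁ n → Linked Δ₂ n
  linked-transfer {θ = θ} {n} Γ⟶Δ₁ θ∈₁ θ∈₂ ∇θ (linked ψ ψ∈ _ ∇nψ ◇n) =
    linked θ θ∈₂ ∇θ
      (∇-antitone (tautology (A ∣ C ⊃ (A ∣ B) ∣ C) (enum n ∷ ψ ∷ θ ∷ []))
              (∇-∨-successor Γ⟶Δ₁ (∋-derive (tautology (B ⊃ A ∣ B) (enum n ∷ ψ ∷ [])) ψ∈) θ∈₁ ∇nψ ∇θ))
      ◇n

  linked-common : ∀ {Δ₁ Δ₂ n} → Linked Δ₁ n → Linked Δ₂ n →
                  Σ Formula λ θ → Γ ∋ ∇ i θ d × Δ₁ ∋ θ × Δ₂ ∋ θ
  linked-common {n = n} (linked ψ₁ ψ₁∈ _ ∇nψ₁ ◇n) (linked ψ₂ ψ₂∈ _ ∇nψ₂ _) =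
    (enum n ∨′ ψ₁) ∨′ (enum n ∨′ ψ₂) ,
    ∇-∨ (◇-mono (tautology (A ⊃ (A ∣ B) & (A ∣ C)) σ) ◇n) ∇nψ₁ ∇nψ₂ ,
    ∋-derive (tautology (B ⊃ (A ∣ B) ∣ (A ∣ C)) σ) ψ₁∈ ,
    ∋-derive (tautology (C ⊃ (A ∣ B) ∣ (A ∣ C)) σ) ψ₂∈
    where
    σ : Vec Formula 3
    σ = enum n ∷ ψ₁ ∷ ψ₂ ∷ []

  Excluded : MCS → FSet
  Excluded Δ α = Σ Formula λ χ → α ≡ ¬′ χ × Δ ∋ χ × Γ ∋ ∇ i χ d

  -- By the union axiom the ∇-known formulas of a successor are closed under ∨, so finitely
  -- many excluded formulas ¬χ all follow from a single ¬D.
  excluded-bound : ∀ {Δ ψ₀ X L} → Γ ⟶[ i ] Δ → Δ ∋ ψ₀ → Γ ∋ ∇ i ψ₀ d → All (X ∪ Excluded Δ) L →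
                   Σ Formula λ D → Δ ∋ D × Γ ∋ ∇ i D d × All (λ α → X α ⊎ (⊢ (¬′ D) ⇒ α)) L
  excluded-bound {ψ₀ = ψ₀} Γ⟶Δ ψ₀∈ ∇ψ₀ [] = ψ₀ , ψ₀∈ , ∇ψ₀ , []
  excluded-bound Γ⟶Δ ψ₀∈ ∇ψ₀ (inj₁ x ∷ L⊆) with excluded-bound Γ⟶Δ ψ₀∈ ∇ψ₀ L⊆
  ... | D , D∈ , ∇D , bounded = D , D∈ , ∇D , inj₁ x ∷ bounded
  excluded-bound Γ⟶Δ ψ₀∈ ∇ψ₀ (inj₂ (χ , refl , χ∈ , ∇χ) ∷ L⊆) with excluded-bound Γ⟶Δ ψ₀∈ ∇ψ₀ L⊆
  ... | D , D∈ , ∇D , bounded =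
    χ ∨′ D , ∋-derive (tautology (A ⊃ A ∣ B) (χ ∷ D ∷ [])) χ∈ , ∇-∨-successor Γ⟶Δ χ∈ D∈ ∇χ ∇D ,
    inj₂ (tautology (~ (A ∣ B) ⊃ ~ A) (χ ∷ D ∷ [])) ∷
    All.map (Sum.map₂ (⊢-trans (tautology (~ (A ∣ B) ⊃ ~ B) (χ ∷ D ∷ [])))) bounded

  separation-consistent : ∀ {φ Δ ψ₀} → ¬ Γ ∋ ∇ i φ d → Γ ⟶[ i ] Δ → Δ ∋ ψ₀ → Γ ∋ ∇ i ψ₀ d →
                          Consistent (Boxed Γ i ∪ ｛ φ ｝ ∪ Excluded Δ)
  separation-consistent {φ} ∇φ∉ Γ⟶Δ ψ₀∈ ∇ψ₀ L L⊆ p with excluded-bound Γ⟶Δ ψ₀∈ ∇ψ₀ L⊆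
  ... | D , D∈ , ∇D , bounded = ∇φ∉ (∇-□-antitone (□-closed (deduction φ⊢D)) ∇D)
    where
    X : FSet
    X = Boxed Γ i ∪ ｛ φ ｝
    under-¬D : ∀ {α} → X α ⊎ (⊢ (¬′ D) ⇒ α) → X ∪ ｛ ¬′ D ｝ ⊢* α
    under-¬D (inj₁ x) = ⊢*-member (inj₁ x)
    under-¬D (inj₂ q) = ⊢*-mp q (⊢*-member (inj₂ refl))
    φ⊢D : X ⊢* D
    φ⊢D = ⊢*-mp (tautology ((~ A ⊃ ⊥ₛ) ⊃ A) (D ∷ [])) (deduction (⊢*-cut (All.map under-¬D bounded) p))

-- Every successor comes in two copies, distinguished by the Bool; the copies receive different
-- values of d when nothing forces them to agree.
data World : Set where
  root  : MCS → World
  child : World → Ag → MCS → Bool → World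

mcs : World → MCS
mcs (root Γ)        = Γ
mcs (child _ _ Δ _) = Δ

data Step (i : Ag) : World → World → Set where
  step : ∀ {w Δ} b → mcs w ⟶[ i ] Δ → Step i w (child w i Δ b)

module _ (lem : LEM) where

  least? : (P : ℕ → Set) → Σ ℕ (Least P) ⊎ (∀ n → ¬ P n)
  least? P with lem (Σ ℕ (Least P))
  ... | inj₁ least = inj₁ least
  ... | inj₂ none  = inj₂ (<-rec _ λ n below Pn → none (n , Pn , λ m<n → below m<n))

  successor : ∀ {Γ i φ} → Consistent (Boxed Γ i ∪ ｛ φ ｝) → Σ MCS λ Δ → Γ ⟶[ i ] Δ × Δ ∋ φ
  successor c with lindenbaum lem c
  ... | Δ , ⊆Δ = Δ , ⊆Δ ∘ inj₁ , ⊆Δ (inj₂ refl)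

  module Valuation (Γ : MCS) (i : Ag) (d : Dc) where
    open Linkage Γ i d

    value : MCS → Bool → ℕ ⊎ Bool
    value Δ b with least? (Linked Δ)
    ... | inj₁ (n , _) = inj₁ n
    ... | inj₂ _       = inj₂ b

    value-linked : ∀ {Δ k} b → Linked Δ k → Σ ℕ λ n → Least (Linked Δ) n × value Δ b ≡ inj₁ n
    value-linked {Δ} b Lk with least? (Linked Δ)
    ... | inj₁ (n , least) = n , least , refl
    ... | inj₂ none        = contradiction Lk (none _)

    value-unlinked : ∀ {Δ} b → (∀ n → ¬ Linked Δ n) → value Δ b ≡ inj₂ b
    value-unlinked {Δ} b unlinked with least? (Linked Δ)
    ... | inj₁ (n , Ln , _) = contradiction Ln (unlinked n)
    ... | inj₂ _            = refl

    value≡inj₁⇒linked : ∀ {Δ b n} → value Δ b ≡ inj₁ n → Linked Δ n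
    value≡inj₁⇒linked {Δ} eq with least? (Linked Δ)
    value≡inj₁⇒linked refl | inj₁ (n , Ln , _) = Ln

    value-agrees : ∀ {Δ₁ Δ₂ θ} b₁ b₂ → Γ ⟶[ i ] Δ₁ → Γ ⟶[ i ] Δ₂ → Δ₁ ∋ θ → Δ₂ ∋ θ → Γ ∋ ∇ i θ d →
                   value Δ₁ b₁ ≡ value Δ₂ b₂
    value-agrees b₁ b₂ Γ⟶Δ₁ Γ⟶Δ₂ θ∈₁ θ∈₂ ∇θ
      with value-linked b₁ (proj₂ (linked-exists Γ⟶Δ₁ θ∈₁ ∇θ))
         | value-linked b₂ (proj₂ (linked-exists Γ⟶Δ₂ θ∈₂ ∇θ))
    ... | n₁ , least₁ , eq₁ | n₂ , least₂ , eq₂ = begin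
      value _ b₁ ≡⟨ eq₁ ⟩
      inj₁ n₁    ≡⟨ cong inj₁ (least-unique (linked-transfer Γ⟶Δ₁ θ∈₁ θ∈₂ ∇θ)
                                             (linked-transfer Γ⟶Δ₂ θ∈₂ θ∈₁ ∇θ) least₁ least₂) ⟩
      inj₁ n₂    ≡⟨ sym eq₂ ⟩
      value _ b₂ ∎
      where open ≡-Reasoning

    record Disagreement (φ : Formula) : Set where
      field
        {Δ₁ Δ₂}   : MCS
        b₁ b₂     : Bool
        Γ⟶Δ₁      : Γ ⟶[ i ] Δ₁
        Γ⟶Δ₂      : Γ ⟶[ i ] Δ₂
        φ∈₁       : Δ₁ ∋ φ
        φ∈₂       : Δ₂ ∋ φ
        disagree  : value Δ₁ b₁ ≢ value Δ₂ b₂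

    separated-disagreement : ∀ {φ Δ₀ ψ₀} → Γ ⟶[ i ] Δ₀ → Δ₀ ∋ φ → Δ₀ ∋ ψ₀ → Γ ∋ ∇ i ψ₀ d →
                             (Δ : MCS) → (Boxed Γ i ∪ ｛ φ ｝ ∪ Excluded Δ₀) ⊆ (Δ ∋_) → Disagreement φ
    separated-disagreement {Δ₀ = Δ₀} Γ⟶Δ₀ φ∈₀ ψ₀∈ ∇ψ₀ Δ ⊆Δ = record
      { b₁ = true ; b₂ = true ; Γ⟶Δ₁ = Γ⟶Δ₀ ; Γ⟶Δ₂ = λ x → ⊆Δ (inj₁ (inj₁ x))
      ; φ∈₁ = φ∈₀ ; φ∈₂ = ⊆Δ (inj₁ (inj₂ refl))
      ; disagree = separated
      }
      where
      separated : value Δ₀ true ≢ value Δ true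
      separated eq with value-linked true (proj₂ (linked-exists Γ⟶Δ₀ ψ₀∈ ∇ψ₀))
      ... | n , (Ln , _) , eq₀ with linked-common Ln (value≡inj₁⇒linked (trans (sym eq) eq₀))
      ... | θ , ∇θ , θ∈₀ , θ∈ = ∋-¬ (⊆Δ (inj₂ (θ , refl , θ∈₀ , ∇θ))) θ∈

    disagreement : ∀ {φ} → ¬ Γ ∋ ∇ i φ d → Disagreement φ
    disagreement ∇φ∉ with successor (∇-consistent ∇φ∉)
    ... | Δ₀ , Γ⟶Δ₀ , φ∈₀ with lem (Σ Formula λ ψ → Δ₀ ∋ ψ × Γ ∋ ∇ i ψ d)
    ... | inj₂ nothing-known = record
      { b₁ = true ; b₂ = false ; Γ⟶Δ₁ = Γ⟶Δ₀ ; Γ⟶Δ₂ = Γ⟶Δ₀ ; φ∈₁ = φ∈₀ ; φ∈₂ = φ∈₀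
      ; disagree = λ eq → contradiction (trans (sym (value-unlinked true unlinked))
                                               (trans eq (value-unlinked false unlinked))) λ ()
      }
      where
      unlinked : ∀ n → ¬ Linked Δ₀ n
      unlinked n (linked ψ ψ∈ ∇ψ _ _) = nothing-known (ψ , ψ∈ , ∇ψ)
    ... | inj₁ (ψ₀ , ψ₀∈ , ∇ψ₀) =
      uncurry (separated-disagreement Γ⟶Δ₀ φ∈₀ ψ₀∈ ∇ψ₀)
              (lindenbaum lem (separation-consistent ∇φ∉ Γ⟶Δ₀ ψ₀∈ ∇ψ₀))

  canonical : MCS → Model
  canonical Γ₀ = record
    { S = World ; O = ℕ ⊎ Bool ; s₀ = root Γ₀ ; o₀ = inj₂ true
    ; R = Step ; V = λ p w → mcs w ∋ var p ; VD = valuation }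
    where
    valuation : Dc → World → ℕ ⊎ Bool
    valuation d (root _)        = inj₂ true   -- roots are never successors, so never compared
    valuation d (child w i Δ b) = Valuation.value (mcs w) i d Δ b

  module Truth (Γ₀ : MCS) where
    M : Model
    M = canonical Γ₀

    Agrees : Formula → Set
    Agrees φ = ∀ w → (M , w ⊨ φ → mcs w ∋ φ) × (mcs w ∋ φ → M , w ⊨ φ)

    □-agrees : ∀ {i φ} → Agrees φ → Agrees (□ i φ)
    □-agrees {i} {φ} ih w = from-model , to-model
      where
      from-model : M , w ⊨ □ i φ → mcs w ∋ □ i φ
      from-model ⊨□φ with ∋-maximal (□ i φ)
      ... | inj₁ □φ∈  = □φ∈
      ... | inj₂ ¬□φ∈ with successor (□-consistent (∋-¬ ¬□φ∈))
      ... | Δ , w⟶Δ , ¬φ∈ = contradiction (proj₁ (ih _) (⊨□φ _ (step true w⟶Δ))) (∋-¬ ¬φ∈)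
      to-model : mcs w ∋ □ i φ → M , w ⊨ □ i φ
      to-model □φ∈ _ (step _ w⟶Δ) = proj₂ (ih _) (w⟶Δ □φ∈)

    ∇-agrees : ∀ {i φ d} → Agrees φ → Agrees (∇ i φ d)
    ∇-agrees {i} {φ} {d} ih w = from-model , to-model
      where
      open Valuation (mcs w) i d
      from-model : M , w ⊨ ∇ i φ d → mcs w ∋ ∇ i φ d
      from-model ⊨∇φ with ∋-maximal (∇ i φ d)
      ... | inj₁ ∇φ∈  = ∇φ∈
      ... | inj₂ ¬∇φ∈ =
        contradiction (⊨∇φ _ _ (step b₁ Γ⟶Δ₁) (step b₂ Γ⟶Δ₂) (proj₂ (ih _) φ∈₁) (proj₂ (ih _) φ∈₂))
                      disagree
        where open Disagreement (disagreement (∋-¬ ¬∇φ∈))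
      to-model : mcs w ∋ ∇ i φ d → M , w ⊨ ∇ i φ d
      to-model ∇φ∈ _ _ (step b₁ w⟶Δ₁) (step b₂ w⟶Δ₂) ⊨φ₁ ⊨φ₂ =
        value-agrees b₁ b₂ w⟶Δ₁ w⟶Δ₂ (proj₁ (ih _) ⊨φ₁) (proj₁ (ih _) ⊨φ₂) ∇φ∈

    truth : ∀ φ → Agrees φ
    truth ⊤′        w = (λ _ → ∋-theorem (tautology ⊤ₛ [])) , (λ _ → tt)
    truth (var p)   w = (λ p∈ → p∈) , (λ p∈ → p∈)
    truth (¬′ φ)    w = (λ ⊭φ → ∌-¬ (⊭φ ∘ proj₂ (truth φ w))) , (λ ¬φ∈ → ∋-¬ ¬φ∈ ∘ proj₁ (truth φ w))
    truth (φ ∧′ ψ)  w =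
      (λ { (⊨φ , ⊨ψ) → ∋-∧ (proj₁ (truth φ w) ⊨φ) (proj₁ (truth ψ w) ⊨ψ) }) ,
      (λ φψ∈ → proj₂ (truth φ w) (∋-∧₁ φψ∈) , proj₂ (truth ψ w) (∋-∧₂ φψ∈))
    truth (□ i φ)   = □-agrees (truth φ)
    truth (∇ i φ d) = ∇-agrees (truth φ)

  completeness : ∀ Δ → Consistent Δ → Satisfiable Δ
  completeness Δ cΔ with lindenbaum lem cΔ
  ... | Γ , Δ⊆Γ = canonical Γ , root Γ , λ φ φ∈Δ → proj₂ (Truth.truth Γ φ (root Γ)) (Δ⊆Γ φ∈Δ)

-- Soundness

infix 4 _≈_

record _≈_ (φ ψ : Formula) : Set₁ where
  constructor mk≈
  field
    to   : ∀ M s → M , s ⊨ φ → M , s ⊨ ψ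
    from : ∀ M s → M , s ⊨ ψ → M , s ⊨ φ

≈-refl : ∀ {α} → α ≈ α
≈-refl = mk≈ (λ _ _ a → a) (λ _ _ a → a)

¬-cong : ∀ {α β} → α ≈ β → ¬′ α ≈ ¬′ β
¬-cong (mk≈ to from) = mk≈ (λ M s ⊭α → ⊭α ∘ from M s) (λ M s ⊭β → ⊭β ∘ to M s)

∧-cong : ∀ {α β γ δ} → α ≈ β → γ ≈ δ → α ∧′ γ ≈ β ∧′ δ
∧-cong (mk≈ to₁ from₁) (mk≈ to₂ from₂) =
  mk≈ (λ M s (a , c) → to₁ M s a , to₂ M s c) (λ M s (b , d) → from₁ M s b , from₂ M s d)

□-cong : ∀ {i α β} → α ≈ β → □ i α ≈ □ i β
□-cong (mk≈ to from) = mk≈ (λ M s h t r → to M t (h t r)) (λ M s h t r → from M t (h t r))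

∇-cong : ∀ {i α β d} → α ≈ β → ∇ i α d ≈ ∇ i β d
∇-cong (mk≈ to from) =
  mk≈ (λ M s h t₁ t₂ r₁ r₂ b₁ b₂ → h t₁ t₂ r₁ r₂ (from M t₁ b₁) (from M t₂ b₂))
      (λ M s h t₁ t₂ r₁ r₂ a₁ a₂ → h t₁ t₂ r₁ r₂ (to M t₁ a₁) (to M t₂ a₂))

replace-≈ : ∀ {ψ χ} → ψ ≈ χ → ∀ φ → φ ≈ φ [ ψ / χ ]
replace-≈ {ψ} ψ≈χ φ with φ ≟F ψ
... | yes refl = ψ≈χ
replace-≈ ψ≈χ ⊤′        | no _ = ≈-refl
replace-≈ ψ≈χ (var p)   | no _ = ≈-refl
replace-≈ ψ≈χ (¬′ α)    | no _ = ¬-cong (replace-≈ ψ≈χ α)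
replace-≈ ψ≈χ (α ∧′ β)  | no _ = ∧-cong (replace-≈ ψ≈χ α) (replace-≈ ψ≈χ β)
replace-≈ ψ≈χ (□ i α)   | no _ = □-cong (replace-≈ ψ≈χ α)
replace-≈ ψ≈χ (∇ i α d) | no _ = ∇-cong (replace-≈ ψ≈χ α)

module _ (lem : LEM) where
  open Classical lem

  evalB-⊨ : ∀ M s φ → evalB (λ p → ⌊ V M p s ⌋) (λ ψ → ⌊ M , s ⊨ ψ ⌋) φ ≡ ⌊ M , s ⊨ φ ⌋
  evalB-⊨ M s ⊤′        = sym (⌊⌋-true tt)
  evalB-⊨ M s (var p)   = refl
  evalB-⊨ M s (¬′ φ)    = trans (cong not (evalB-⊨ M s φ)) (sym ⌊¬⌋)
  evalB-⊨ M s (φ ∧′ ψ)  = trans (cong₂ _∧_ (evalB-⊨ M s φ) (evalB-⊨ M s ψ)) (sym ⌊×⌋)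
  evalB-⊨ M s (□ i φ)   = refl
  evalB-⊨ M s (∇ i φ d) = refl

  ∇-∨-sound : ∀ M s i φ ψ d → M , s ⊨ ◇ i (φ ∧′ ψ) → M , s ⊨ ∇ i φ d → M , s ⊨ ∇ i ψ d →
              M , s ⊨ ∇ i (φ ∨′ ψ) d
  ∇-∨-sound M s i φ ψ d ◇φψ ∇φ ∇ψ t₁ t₂ r₁ r₂ ⊨₁ ⊨₂ with ¬∀¬⇒∃ ◇φψ
  ... | u , r , u⊨φ , u⊨ψ = same (∨-elim ⊨₁) (∨-elim ⊨₂)
    where
    same : M , t₁ ⊨ φ ⊎ M , t₁ ⊨ ψ → M , t₂ ⊨ φ ⊎ M , t₂ ⊨ ψ → VD M d t₁ ≡ VD M d t₂
    same (inj₁ a) (inj₁ b) = ∇φ t₁ t₂ r₁ r₂ a b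
    same (inj₁ a) (inj₂ b) = trans (∇φ t₁ u r₁ r a u⊨φ) (∇ψ u t₂ r r₂ u⊨ψ b)
    same (inj₂ a) (inj₁ b) = trans (∇ψ t₁ u r₁ r a u⊨ψ) (∇φ u t₂ r r₂ u⊨φ b)
    same (inj₂ a) (inj₂ b) = ∇ψ t₁ t₂ r₁ r₂ a b

  soundness : ∀ {φ} → ⊢ φ → ∀ M s → M , s ⊨ φ
  soundness (taut {φ} t) M s = ⌊⌋-elim (trans (sym (evalB-⊨ M s φ)) (t _ _))
  soundness (axK i φ ψ) M s =
    ⇒-intro λ □φ⇒ψ → ⇒-intro λ □φ t r → ⇒-elim (□φ⇒ψ t r) (□φ t r)
  soundness (axMono i φ ψ d) M s =
    ⇒-intro λ □φ⇒ψ → ⇒-intro λ ∇ψ t₁ t₂ r₁ r₂ a₁ a₂ →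
      ∇ψ t₁ t₂ r₁ r₂ (⇒-elim (□φ⇒ψ t₁ r₁) a₁) (⇒-elim (□φ⇒ψ t₂ r₂) a₂)
  soundness (axBot i d) M s _ _ _ _ ⊨⊥ _ = ⊥-elim (⊨⊥ tt)
  soundness (axUnion i φ ψ d) M s = ⇒-intro λ (◇φψ , ∇φ , ∇ψ) → ∇-∨-sound M s i φ ψ d ◇φψ ∇φ ∇ψ
  soundness (mp p q) M s = ⇒-elim (soundness p M s) (soundness q M s)
  soundness (nec i p) M s t _ = soundness p M t
  soundness (repl {ψ} {χ} φ p) M s = ⇒-intro (_≈_.to φ≈ M s) , ⇒-intro (_≈_.from φ≈ M s)
    where
    φ≈ : φ ≈ φ [ ψ / χ ]
    φ≈ = replace-≈ (mk≈ (λ M s → ⇒-elim (proj₁ (soundness p M s)))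
                        (λ M s → ⇒-elim (proj₂ (soundness p M s)))) φ

theorem1 : LEM →
    ((φ : Formula) → ⊢ φ → (M : Model) (s : S M) → M , s ⊨ φ)
    × ((Δ : FSet) → Consistent Δ → Satisfiable Δ)
theorem1 lem = (λ _ → soundness lem) , completeness lem
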